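{- Let $n\ge2$, let $\alpha=(\alpha_1,\dots,\alpha_\ell)$ be a composition of $n$, let $1\le r\le n$ and let $i$ satisfy $\alpha_i=1$. Then for all $k$, $$[q^k]\,b^r_\alpha(i;q)=[q^k]\,b^{n+1-r}_{\alpha^{rev}}(\ell-i+1;q).$$ Consequently $b_\alpha(i;q)=b_{\alpha^{rev}}(\ell-i+1;q)$, where $b_\alpha(i;q)=\sum_{r=1}^n b^r_\alpha(i;q)$.
   Context: The star graph $\mathrm{St}_n$ has $n$ vertices, a root $v_0$, and edges exactly $\{v_0,v\}$ for $v\ne v_0$. A labeling is a bijection $L:V\to\{1,\dots,n\}$; a proper coloring is $\kappa:V\to\mathbb{Z}_{>0}$ with adjacent vertices colored differently; $\mathrm{asc}^L(\kappa)$ counts edges $\{u,v\}$ with $L(u)<L(v)$ and $\kappa(u)<\kappa(v)$. For a composition $\alpha$ of $n$ with $\ell$ parts, $1\le r\le n$ and $i$ with $\alpha_i=1$, define $b^r_\alpha(i;q)=\sum_\kappa q^{\mathrm{asc}^L(\kappa)}$, where $L$ is a labeling with $L(v_0)=r$ and $\kappa$ runs over proper colorings $V\to\{1,\dots,\ell\}$ with $\#\kappa^{ -1}(j)=\alpha_j$ for all $j$ and $\kappa(v_0)=i$ (this polynomial does not depend on the choice of $L$ with $L(v_0)=r$). $\alpha^{rev}=(\alpha_\ell,\dots,\alpha_1)$. -}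

module Defs where

open import Data.Nat using (ℕ; zero; suc; _+_; _≤_)
open import Data.Nat.Properties using (_≟_)
open import Data.Bool using (Bool; true; false; _∧_; _∨_; if_then_else_)
open import Data.Fin using (Fin; zero; suc; _<?_; opposite)
import Data.Fin.Properties as FinP
open import Data.Vec using (Vec; lookup; reverse)
open import Data.Vec.Functional as VF using ()
open import Data.List using (List; []; _∷_; map; concatMap; allFin)
open import Data.Nat.ListAction using (sum)
open import Relation.Nullary.Decidable using (⌊_⌋; ¬?)
open import Function.Bundles using (_⤖_; Bijection)

-- Vertices of the star graph St_n are Fin n (n = suc m); the root v₀ is zero,
-- the leaves are suc j.  Edges: {zero , suc j} for j : Fin m.

-- Labelings: bijections V → {1..n}, label value j : Fin n standing for j+1.
Labeling : ℕ → Set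
Labeling n = Fin n ⤖ Fin n

lab : ∀ {n} → Labeling n → Fin n → Fin n
lab L = Bijection.to L

-- Colorings V → {1..ℓ}, colour c : Fin ℓ standing for c+1.
Coloring : ℕ → ℕ → Set
Coloring n ℓ = Fin n → Fin ℓ

allColorings : ∀ n ℓ → List (Coloring n ℓ)
allColorings zero ℓ = (λ ()) ∷ []
allColorings (suc n) ℓ =
  concatMap (λ c → map (λ f → c VF.∷ f) (allColorings n ℓ)) (allFin ℓ)

count : ∀ {n} → (Fin n → Bool) → ℕ
count {n} p = sum (map (λ v → if p v then 1 else 0) (allFin n))

allᶠ : ∀ {n} → (Fin n → Bool) → Bool
allᶠ {zero} p = true
allᶠ {suc n} p = p zero ∧ allᶠ (λ j → p (suc j))

_==ᶠ_ : ∀ {ℓ} → Fin ℓ → Fin ℓ → Bool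
a ==ᶠ b = ⌊ a FinP.≟ b ⌋

_<ᵇ_ : ∀ {ℓ} → Fin ℓ → Fin ℓ → Bool
a <ᵇ b = ⌊ a <? b ⌋

_==ⁿ_ : ℕ → ℕ → Bool
a ==ⁿ b = ⌊ a ≟ b ⌋

proper : ∀ {m ℓ} → Coloring (suc m) ℓ → Bool
proper {m} κ = allᶠ {m} (λ j → Data.Bool.not (κ zero ==ᶠ κ (suc j)))
  where import Data.Bool

hasContent : ∀ {n ℓ} → Vec ℕ ℓ → Coloring n ℓ → Bool
hasContent α κ = allᶠ (λ j → count (λ v → κ v ==ᶠ j) ==ⁿ lookup α j)

asc : ∀ {m ℓ} → Labeling (suc m) → Coloring (suc m) ℓ → ℕ
asc {m} L κ = count {m} (λ j →
    (lab L zero <ᵇ lab L (suc j) ∧ κ zero <ᵇ κ (suc j))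
  ∨ (lab L (suc j) <ᵇ lab L zero ∧ κ (suc j) <ᵇ κ zero))

-- [q^k] b^r_α(i;q), where r is given through the labeling L with L(v₀) = r:
-- number of proper colorings κ : V → {1..ℓ} with content α, κ(v₀) = i and asc^L(κ) = k.
bCoeff : ∀ {m ℓ} → Vec ℕ ℓ → Labeling (suc m) → Fin ℓ → ℕ → ℕ
bCoeff {m} {ℓ} α L i k = sum (map (λ κ →
    if proper κ ∧ hasContent α κ ∧ (κ zero ==ᶠ i) ∧ (asc L κ ==ⁿ k) then 1 else 0)
  (allColorings (suc m) ℓ))

ΣFin : ∀ n → (Fin n → ℕ) → ℕ
ΣFin n f = sum (map f (allFin n))

{-# OPTIONS --safe #-}
-- In 1-based terms, opposite is x ↦ n + 1 − x.  Replacing a colouring κ by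
-- opposite ∘ κ and the labeling L by opposite ∘ L reverses both inequalities in the
-- definition of an ascent, so the ascent number is unchanged; the content α becomes
-- α^rev, the root colour i becomes ℓ + 1 − i, and properness is kept.  This is the
-- symmetry for the reversed labeling.  Any other labeling L′ with the same root label
-- is reached by composing with the vertex permutation L⁻¹ ∘ L′, which fixes the root
-- and hence only permutes the leaves of the star, so b^r_α(i;q) depends on L only
-- through r.  The statement for b_α(i;q) follows by reindexing r ↦ n + 1 − r.
module Submission where

open import Defs
open import Data.Nat using (ℕ; zero; suc; _+_; _≤_; s≤s)
open import Data.Fin using (Fin; zero; suc; opposite; fromℕ; inject₁; punchIn; _<_; _<?_)
open import Data.Vec using (Vec; []; _∷_; _∷ʳ_; lookup; reverse; sum)
open import Data.Vec.Relation.Unary.All using (All)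
open import Data.Product using (_×_; _,_)
open import Relation.Binary.PropositionalEquality using (_≡_)

import Algebra.Properties.CommutativeMonoid.Sum as CommutativeMonoidSum
open import Data.Bool using (Bool; _∧_; _∨_; not; if_then_else_)
open import Data.Bool.Properties using (∨-comm; ∧-commutativeMonoid)
open import Data.Fin.Properties using (toℕ<n; opposite-prop; opposite-involutive)
  renaming (_≟_ to _≟ᶠ_)
open import Data.Fin.Permutation as Perm
  using (Permutation′; _⟨$⟩ʳ_; _⟨$⟩ˡ_; _∘ₚ_; inverseʳ; inverseˡ; remove; punchIn-permute)
open import Data.List using (List; []; _∷_; _++_; map; concatMap; allFin; tabulate)
open import Data.List.Properties using (map-cong; map-∘; map-++; map-tabulate)
open import Data.Nat.ListAction using () renaming (sum to sumᴸ)
open import Data.Nat.ListAction.Properties using (sum-++)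
open import Data.Nat.Properties using (+-0-commutativeMonoid; ∸-monoʳ-<)
open import Data.Vec.Properties using (reverse-∷)
open import Data.Vec.Functional using (insertAt) renaming (_∷_ to _∷ᶠ_)
open import Data.Vec.Functional.Properties using (insertAt-lookup; insertAt-punchIn)
open import Function using (id; _∘_; _⇔_; mk⇔)
open import Function.Properties.Bijection using (⤖⇒↔)
open import Function.Properties.Inverse using (↔⇒⤖)
open import Relation.Binary.Core using (_Preserves_⟶_)
open import Relation.Binary.PropositionalEquality
  using (refl; sym; trans; cong; cong₂; subst₂; _≗_; module ≡-Reasoning)
open import Relation.Nullary.Decidable using (Dec; ⌊_⌋; does-⇔; isYes≗does)

private
  module ℕΣ = CommutativeMonoidSum +-0-commutativeMonoid
  module ∧Σ = CommutativeMonoidSum ∧-commutativeMonoid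

  variable
    A B : Set
    m n ℓ : ℕ

sum-tabulate : (f : Fin n → ℕ) → sumᴸ (tabulate f) ≡ ℕΣ.sum f
sum-tabulate {zero} f = refl
sum-tabulate {suc n} f = cong (f zero +_) (sum-tabulate (f ∘ suc))

ΣFin≡sum : (f : Fin n → ℕ) → ΣFin n f ≡ ℕΣ.sum f
ΣFin≡sum {n} f = trans (cong sumᴸ (map-tabulate {n = n} id f)) (sum-tabulate f)

ΣFin-cong : {f g : Fin n → ℕ} → f ≗ g → ΣFin n f ≡ ΣFin n g
ΣFin-cong {n} f≗g = cong sumᴸ (map-cong f≗g (allFin n))

ΣFin-permute : (f : Fin n → ℕ) (π : Permutation′ n) → ΣFin n (f ∘ (π ⟨$⟩ʳ_)) ≡ ΣFin n f
ΣFin-permute f π = begin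
  ΣFin _ (f ∘ (π ⟨$⟩ʳ_)) ≡⟨ ΣFin≡sum (f ∘ (π ⟨$⟩ʳ_)) ⟩
  ℕΣ.sum (f ∘ (π ⟨$⟩ʳ_)) ≡⟨ ℕΣ.sum-permute f π ⟨
  ℕΣ.sum f               ≡⟨ ΣFin≡sum f ⟨
  ΣFin _ f               ∎
  where open ≡-Reasoning

sum-map-concatMap : (f : B → ℕ) (g : A → List B) (xs : List A) →
  sumᴸ (map f (concatMap g xs)) ≡ sumᴸ (map (λ x → sumᴸ (map f (g x))) xs)
sum-map-concatMap f g []       = refl
sum-map-concatMap f g (x ∷ xs) = begin
  sumᴸ (map f (g x ++ concatMap g xs))
    ≡⟨ cong sumᴸ (map-++ f (g x) (concatMap g xs)) ⟩
  sumᴸ (map f (g x) ++ map f (concatMap g xs))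
    ≡⟨ sum-++ (map f (g x)) _ ⟩
  sumᴸ (map f (g x)) + sumᴸ (map f (concatMap g xs))
    ≡⟨ cong (sumᴸ (map f (g x)) +_) (sum-map-concatMap f g xs) ⟩
  sumᴸ (map f (g x)) + sumᴸ (map (λ x → sumᴸ (map f (g x))) xs) ∎
  where open ≡-Reasoning

colouringSum : ∀ n ℓ → (Coloring n ℓ → ℕ) → ℕ
colouringSum n ℓ f = sumᴸ (map f (allColorings n ℓ))

colouringSum-cong : {f g : Coloring n ℓ → ℕ} → f ≗ g →
  colouringSum n ℓ f ≡ colouringSum n ℓ g
colouringSum-cong {n} {ℓ} f≗g = cong sumᴸ (map-cong f≗g (allColorings n ℓ))

colouringSum-∷ : (f : Coloring (suc n) ℓ → ℕ) →
  colouringSum (suc n) ℓ f ≡ ℕΣ.sum (λ c → colouringSum n ℓ (λ κ → f (c ∷ᶠ κ)))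
colouringSum-∷ {n} {ℓ} f = begin
  colouringSum (suc n) ℓ f
    ≡⟨ sum-map-concatMap f _ (allFin ℓ) ⟩
  ΣFin ℓ (λ c → sumᴸ (map f (map (c ∷ᶠ_) (allColorings n ℓ))))
    ≡⟨ ΣFin-cong (λ c → cong sumᴸ (map-∘ {g = f} {f = c ∷ᶠ_} (allColorings n ℓ))) ⟨
  ΣFin ℓ (λ c → colouringSum n ℓ (λ κ → f (c ∷ᶠ κ)))
    ≡⟨ ΣFin≡sum (λ c → colouringSum n ℓ (λ κ → f (c ∷ᶠ κ))) ⟩
  ℕΣ.sum (λ c → colouringSum n ℓ (λ κ → f (c ∷ᶠ κ))) ∎
  where open ≡-Reasoning

∷ᶠ-cong : (c : A) {κ κ′ : Fin n → A} → κ ≗ κ′ → c ∷ᶠ κ ≗ c ∷ᶠ κ′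
∷ᶠ-cong c κ≗κ′ zero    = refl
∷ᶠ-cong c κ≗κ′ (suc v) = κ≗κ′ v

-- Without function extensionality, f has to be assumed to respect pointwise equality
-- of colourings: the recursion rebuilds colourings only up to ≗.
colouringSum-insertAt : (f : Coloring (suc n) ℓ → ℕ) → f Preserves _≗_ ⟶ _≡_ →
  (p : Fin (suc n)) →
  colouringSum (suc n) ℓ f ≡ ℕΣ.sum (λ c → colouringSum n ℓ (λ κ → f (insertAt κ p c)))
colouringSum-insertAt {n} {ℓ} f f-cong zero = trans (colouringSum-∷ f)
  (ℕΣ.sum-cong-≗ (λ c → colouringSum-cong (λ κ → f-cong (insertAt-zero c κ))))
  where
  insertAt-zero : ∀ c κ → c ∷ᶠ κ ≗ insertAt κ zero c
  insertAt-zero c κ zero    = refl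
  insertAt-zero c κ (suc v) = refl
colouringSum-insertAt {suc n} {ℓ} f f-cong (suc p) = begin
  colouringSum (suc (suc n)) ℓ f
    ≡⟨ colouringSum-∷ f ⟩
  ℕΣ.sum (λ a → colouringSum (suc n) ℓ (λ κ → f (a ∷ᶠ κ)))
    ≡⟨ ℕΣ.sum-cong-≗ (λ a → colouringSum-insertAt _ (f-cong ∘ ∷ᶠ-cong a) p) ⟩
  ℕΣ.sum (λ a → ℕΣ.sum (λ c → colouringSum n ℓ (λ κ → f (a ∷ᶠ insertAt κ p c))))
    ≡⟨ ℕΣ.∑-comm (λ a c → colouringSum n ℓ (λ κ → f (a ∷ᶠ insertAt κ p c))) ⟩
  ℕΣ.sum (λ c → ℕΣ.sum (λ a → colouringSum n ℓ (λ κ → f (a ∷ᶠ insertAt κ p c))))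
    ≡⟨ ℕΣ.sum-cong-≗ (λ c → ℕΣ.sum-cong-≗ (λ a →
         colouringSum-cong (λ κ → f-cong (insertAt-suc a c κ)))) ⟩
  ℕΣ.sum (λ c → ℕΣ.sum (λ a → colouringSum n ℓ (λ κ → f (insertAt (a ∷ᶠ κ) (suc p) c))))
    ≡⟨ ℕΣ.sum-cong-≗ (λ c → colouringSum-∷ (λ κ → f (insertAt κ (suc p) c))) ⟨
  ℕΣ.sum (λ c → colouringSum (suc n) ℓ (λ κ → f (insertAt κ (suc p) c))) ∎
  where
  open ≡-Reasoning
  insertAt-suc : ∀ a c κ → a ∷ᶠ insertAt κ p c ≗ insertAt (a ∷ᶠ κ) (suc p) c
  insertAt-suc a c κ zero    = refl
  insertAt-suc a c κ (suc v) = refl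

-- Splitting off the colour of vertex π 0 reduces π to remove zero π on the other vertices.
colouringSum-permuteVertices : (f : Coloring n ℓ → ℕ) → f Preserves _≗_ ⟶ _≡_ →
  (π : Permutation′ n) → colouringSum n ℓ (λ κ → f (κ ∘ (π ⟨$⟩ʳ_))) ≡ colouringSum n ℓ f
colouringSum-permuteVertices {zero} f f-cong π = cong (_+ 0) (f-cong (λ ()))
colouringSum-permuteVertices {suc n} {ℓ} f f-cong π = begin
  colouringSum (suc n) ℓ (λ κ → f (κ ∘ (π ⟨$⟩ʳ_)))
    ≡⟨ colouringSum-insertAt _ (λ κ≗κ′ → f-cong (κ≗κ′ ∘ (π ⟨$⟩ʳ_))) p ⟩
  ℕΣ.sum (λ c → colouringSum n ℓ (λ κ → f (insertAt κ p c ∘ (π ⟨$⟩ʳ_))))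
    ≡⟨ ℕΣ.sum-cong-≗ (λ c → colouringSum-cong (λ κ → f-cong (insertAt-∘π c κ))) ⟩
  ℕΣ.sum (λ c → colouringSum n ℓ (λ κ → f (c ∷ᶠ (κ ∘ (ρ ⟨$⟩ʳ_)))))
    ≡⟨ ℕΣ.sum-cong-≗ (λ c →
         colouringSum-permuteVertices (λ κ → f (c ∷ᶠ κ)) (f-cong ∘ ∷ᶠ-cong c) ρ) ⟩
  ℕΣ.sum (λ c → colouringSum n ℓ (λ κ → f (c ∷ᶠ κ)))
    ≡⟨ colouringSum-∷ f ⟨
  colouringSum (suc n) ℓ f ∎
  where
  open ≡-Reasoning
  p : Fin (suc n)
  p = π ⟨$⟩ʳ zero
  ρ : Permutation′ n
  ρ = remove zero π
  insertAt-∘π : ∀ c κ → insertAt κ p c ∘ (π ⟨$⟩ʳ_) ≗ c ∷ᶠ (κ ∘ (ρ ⟨$⟩ʳ_))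
  insertAt-∘π c κ zero    = insertAt-lookup κ p c
  insertAt-∘π c κ (suc v) = trans (cong (insertAt κ p c) (punchIn-permute π zero v))
                                  (insertAt-punchIn κ p c (ρ ⟨$⟩ʳ v))

∘-∷ᶠ : (g : A → B) (c : A) (κ : Fin n → A) → g ∘ (c ∷ᶠ κ) ≗ g c ∷ᶠ (g ∘ κ)
∘-∷ᶠ g c κ zero    = refl
∘-∷ᶠ g c κ (suc v) = refl

colouringSum-permuteColours : (f : Coloring n ℓ → ℕ) → f Preserves _≗_ ⟶ _≡_ →
  (σ : Permutation′ ℓ) → colouringSum n ℓ (λ κ → f ((σ ⟨$⟩ʳ_) ∘ κ)) ≡ colouringSum n ℓ f
colouringSum-permuteColours {zero} f f-cong σ = cong (_+ 0) (f-cong (λ ()))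
colouringSum-permuteColours {suc n} {ℓ} f f-cong σ = begin
  colouringSum (suc n) ℓ (λ κ → f ((σ ⟨$⟩ʳ_) ∘ κ))
    ≡⟨ colouringSum-∷ (λ κ → f ((σ ⟨$⟩ʳ_) ∘ κ)) ⟩
  ℕΣ.sum (λ c → colouringSum n ℓ (λ κ → f ((σ ⟨$⟩ʳ_) ∘ (c ∷ᶠ κ))))
    ≡⟨ ℕΣ.sum-cong-≗ (λ c → colouringSum-cong (λ κ → f-cong (∘-∷ᶠ (σ ⟨$⟩ʳ_) c κ))) ⟩
  ℕΣ.sum (λ c → colouringSum n ℓ (λ κ → f ((σ ⟨$⟩ʳ c) ∷ᶠ ((σ ⟨$⟩ʳ_) ∘ κ))))
    ≡⟨ ℕΣ.sum-cong-≗ (λ c →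
         colouringSum-permuteColours (λ κ → f ((σ ⟨$⟩ʳ c) ∷ᶠ κ)) (f-cong ∘ ∷ᶠ-cong _) σ) ⟩
  ℕΣ.sum (λ c → colouringSum n ℓ (λ κ → f ((σ ⟨$⟩ʳ c) ∷ᶠ κ)))
    ≡⟨ ℕΣ.sum-permute (λ c → colouringSum n ℓ (λ κ → f (c ∷ᶠ κ))) σ ⟨
  ℕΣ.sum (λ c → colouringSum n ℓ (λ κ → f (c ∷ᶠ κ)))
    ≡⟨ colouringSum-∷ f ⟨
  colouringSum (suc n) ℓ f ∎
  where open ≡-Reasoning

allᶠ-cong : {p q : Fin n → Bool} → p ≗ q → allᶠ p ≡ allᶠ q
allᶠ-cong {zero}  p≗q = refl
allᶠ-cong {suc n} p≗q = cong₂ _∧_ (p≗q zero) (allᶠ-cong (p≗q ∘ suc))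

allᶠ≡∧-sum : (p : Fin n → Bool) → allᶠ p ≡ ∧Σ.sum p
allᶠ≡∧-sum {zero}  p = refl
allᶠ≡∧-sum {suc n} p = cong (p zero ∧_) (allᶠ≡∧-sum (p ∘ suc))

allᶠ-permute : (p : Fin n → Bool) (π : Permutation′ n) → allᶠ (p ∘ (π ⟨$⟩ʳ_)) ≡ allᶠ p
allᶠ-permute p π = begin
  allᶠ (p ∘ (π ⟨$⟩ʳ_))  ≡⟨ allᶠ≡∧-sum (p ∘ (π ⟨$⟩ʳ_)) ⟩
  ∧Σ.sum (p ∘ (π ⟨$⟩ʳ_)) ≡⟨ ∧Σ.sum-permute p π ⟨
  ∧Σ.sum p               ≡⟨ allᶠ≡∧-sum p ⟨
  allᶠ p                 ∎
  where open ≡-Reasoning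

indicator : Bool → ℕ
indicator b = if b then 1 else 0

count-cong : {p q : Fin n → Bool} → p ≗ q → count p ≡ count q
count-cong p≗q = ΣFin-cong (cong indicator ∘ p≗q)

opposite-injective : {a b : Fin n} → opposite a ≡ opposite b → a ≡ b
opposite-injective {a = a} {b} eq = begin
  a                     ≡⟨ opposite-involutive a ⟨
  opposite (opposite a) ≡⟨ cong opposite eq ⟩
  opposite (opposite b) ≡⟨ opposite-involutive b ⟩
  b                     ∎
  where open ≡-Reasoning

opposite-reverses-< : {a b : Fin n} → a < b → opposite b < opposite a
opposite-reverses-< {suc n} {a} {b} a<b rewrite opposite-prop a | opposite-prop b =
  ∸-monoʳ-< (s≤s a<b) (toℕ<n b)

opposite-<⇔ : {a b : Fin n} → opposite a < opposite b ⇔ b < a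
opposite-<⇔ {a = a} {b} = mk⇔ reflect opposite-reverses-<
  where
  reflect : opposite a < opposite b → b < a
  reflect lt = subst₂ _<_ (opposite-involutive b) (opposite-involutive a)
                       (opposite-reverses-< lt)

⌊⌋-⇔ : {P Q : Set} → P ⇔ Q → (p? : Dec P) (q? : Dec Q) → ⌊ p? ⌋ ≡ ⌊ q? ⌋
⌊⌋-⇔ P⇔Q p? q? = trans (isYes≗does p?) (trans (does-⇔ P⇔Q p? q?) (sym (isYes≗does q?)))

==ᶠ-opposite : (a b : Fin n) → (opposite a ==ᶠ opposite b) ≡ (a ==ᶠ b)
==ᶠ-opposite a b =
  ⌊⌋-⇔ (mk⇔ opposite-injective (cong opposite)) (opposite a ≟ᶠ opposite b) (a ≟ᶠ b)

<ᵇ-opposite : (a b : Fin n) → (opposite a <ᵇ opposite b) ≡ (b <ᵇ a)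
<ᵇ-opposite a b = ⌊⌋-⇔ opposite-<⇔ (opposite a <? opposite b) (b <? a)

lookup-∷ʳ-fromℕ : (xs : Vec A n) (x : A) → lookup (xs ∷ʳ x) (fromℕ n) ≡ x
lookup-∷ʳ-fromℕ []       x = refl
lookup-∷ʳ-fromℕ (_ ∷ xs) x = lookup-∷ʳ-fromℕ xs x

lookup-∷ʳ-inject₁ : (xs : Vec A n) (x : A) (j : Fin n) →
  lookup (xs ∷ʳ x) (inject₁ j) ≡ lookup xs j
lookup-∷ʳ-inject₁ (y ∷ xs) x zero    = refl
lookup-∷ʳ-inject₁ (y ∷ xs) x (suc j) = lookup-∷ʳ-inject₁ xs x j

lookup-reverse : (xs : Vec A n) (j : Fin n) → lookup (reverse xs) (opposite j) ≡ lookup xs j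
lookup-reverse (x ∷ xs) zero rewrite reverse-∷ x xs = lookup-∷ʳ-fromℕ (reverse xs) x
lookup-reverse (x ∷ xs) (suc j) rewrite reverse-∷ x xs =
  trans (lookup-∷ʳ-inject₁ (reverse xs) x (opposite j)) (lookup-reverse xs j)

isAscent : Fin n → Fin n → Fin ℓ → Fin ℓ → Bool
isAscent a b c d = (a <ᵇ b ∧ c <ᵇ d) ∨ (b <ᵇ a ∧ d <ᵇ c)

isAscent-opposite : (a b : Fin n) (c d : Fin ℓ) →
  isAscent (opposite a) (opposite b) (opposite c) (opposite d) ≡ isAscent a b c d
isAscent-opposite a b c d
  rewrite <ᵇ-opposite a b | <ᵇ-opposite b a | <ᵇ-opposite c d | <ᵇ-opposite d c =
  ∨-comm (b <ᵇ a ∧ d <ᵇ c) (a <ᵇ b ∧ c <ᵇ d)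

isCounted : Vec ℕ ℓ → Labeling (suc m) → Fin ℓ → ℕ → Coloring (suc m) ℓ → Bool
isCounted α L i k κ = proper κ ∧ hasContent α κ ∧ (κ zero ==ᶠ i) ∧ (asc L κ ==ⁿ k)

isCounted-cong : (α : Vec ℕ ℓ) (L : Labeling (suc m)) (i : Fin ℓ) (k : ℕ) →
  isCounted α L i k Preserves _≗_ ⟶ _≡_
isCounted-cong α L i k {κ} {κ′} κ≗κ′ =
  cong₂ _∧_ proper≡ (cong₂ _∧_ hasContent≡ (cong₂ _∧_ (cong (_==ᶠ i) (κ≗κ′ zero)) asc≡))
  where
  proper≡ : proper κ ≡ proper κ′
  proper≡ = allᶠ-cong (λ j → cong₂ (λ c d → not (c ==ᶠ d)) (κ≗κ′ zero) (κ≗κ′ (suc j)))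
  hasContent≡ : hasContent α κ ≡ hasContent α κ′
  hasContent≡ = allᶠ-cong (λ j →
    cong (_==ⁿ lookup α j) (count-cong (λ v → cong (_==ᶠ j) (κ≗κ′ v))))
  asc≡ : (asc L κ ==ⁿ k) ≡ (asc L κ′ ==ⁿ k)
  asc≡ = cong (_==ⁿ k) (count-cong (λ j →
    cong₂ (isAscent (lab L zero) (lab L (suc j))) (κ≗κ′ zero) (κ≗κ′ (suc j))))

hasContent-permute : (α : Vec ℕ ℓ) (κ : Coloring n ℓ) (π : Permutation′ n) →
  hasContent α (κ ∘ (π ⟨$⟩ʳ_)) ≡ hasContent α κ
hasContent-permute α κ π = allᶠ-cong (λ c →
  cong (_==ⁿ lookup α c) (ΣFin-permute (λ v → indicator (κ v ==ᶠ c)) π))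

reverseLabeling : Labeling n → Labeling n
reverseLabeling L = ↔⇒⤖ (⤖⇒↔ L ∘ₚ Perm.reverse)

proper-opposite : (κ : Coloring (suc m) ℓ) → proper (opposite ∘ κ) ≡ proper κ
proper-opposite κ = allᶠ-cong (λ j → cong not (==ᶠ-opposite (κ zero) (κ (suc j))))

hasContent-opposite : (α : Vec ℕ ℓ) (κ : Coloring n ℓ) →
  hasContent (reverse α) (opposite ∘ κ) ≡ hasContent α κ
hasContent-opposite α κ = begin
  hasContent (reverse α) (opposite ∘ κ)
    ≡⟨ allᶠ-permute (λ j → count (λ v → opposite (κ v) ==ᶠ j) ==ⁿ lookup (reverse α) j)
                    Perm.reverse ⟨
  allᶠ (λ j → count (λ v → opposite (κ v) ==ᶠ opposite j) ==ⁿ lookup (reverse α) (opposite j))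
    ≡⟨ allᶠ-cong (λ j → cong₂ _==ⁿ_ (count-cong (λ v → ==ᶠ-opposite (κ v) j))
                                     (lookup-reverse α j)) ⟩
  hasContent α κ ∎
  where open ≡-Reasoning

asc-opposite : (L : Labeling (suc m)) (κ : Coloring (suc m) ℓ) →
  asc (reverseLabeling L) (opposite ∘ κ) ≡ asc L κ
asc-opposite L κ = count-cong (λ j →
  isAscent-opposite (lab L zero) (lab L (suc j)) (κ zero) (κ (suc j)))

isCounted-opposite : (α : Vec ℕ ℓ) (L : Labeling (suc m)) (i : Fin ℓ) (k : ℕ)
  (κ : Coloring (suc m) ℓ) →
  isCounted (reverse α) (reverseLabeling L) (opposite i) k (opposite ∘ κ)
    ≡ isCounted α L i k κ
isCounted-opposite α L i k κ =
  cong₂ _∧_ (proper-opposite κ)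
   (cong₂ _∧_ (hasContent-opposite α κ)
    (cong₂ _∧_ (==ᶠ-opposite (κ zero) i) (cong (_==ⁿ k) (asc-opposite L κ))))

bCoeff-reverse : (α : Vec ℕ ℓ) (L : Labeling (suc m)) (i : Fin ℓ) (k : ℕ) →
  bCoeff α L i k ≡ bCoeff (reverse α) (reverseLabeling L) (opposite i) k
bCoeff-reverse {ℓ} {m} α L i k = begin
  bCoeff α L i k ≡⟨⟩
  colouringSum (suc m) ℓ (indicator ∘ isCounted α L i k)
    ≡⟨ colouringSum-cong (λ κ → cong indicator (isCounted-opposite α L i k κ)) ⟨
  colouringSum (suc m) ℓ (λ κ → indicator (isCounted α̅ (reverseLabeling L) ī k (opposite ∘ κ)))
    ≡⟨ colouringSum-permuteColours (indicator ∘ isCounted α̅ (reverseLabeling L) ī k)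
         (cong indicator ∘ isCounted-cong α̅ (reverseLabeling L) ī k) Perm.reverse ⟩
  colouringSum (suc m) ℓ (indicator ∘ isCounted α̅ (reverseLabeling L) ī k) ∎
  where
  open ≡-Reasoning
  α̅ : Vec ℕ ℓ
  α̅ = reverse α
  ī : Fin ℓ
  ī = opposite i

module _ (π : Permutation′ (suc m)) (π-root : π ⟨$⟩ʳ zero ≡ zero) where

  π-leaf : (j : Fin m) → π ⟨$⟩ʳ suc j ≡ suc (remove zero π ⟨$⟩ʳ j)
  π-leaf j = trans (punchIn-permute π zero j)
                   (cong (λ r → punchIn r (remove zero π ⟨$⟩ʳ j)) π-root)

  allᶠ-leaves-permute : (h : Fin (suc m) → Fin (suc m) → Bool) →
    allᶠ (λ j → h (π ⟨$⟩ʳ zero) (π ⟨$⟩ʳ suc j)) ≡ allᶠ (λ j → h zero (suc j))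
  allᶠ-leaves-permute h =
    trans (allᶠ-cong (λ j → cong₂ h π-root (π-leaf j)))
          (allᶠ-permute (λ j → h zero (suc j)) (remove zero π))

  count-leaves-permute : (h : Fin (suc m) → Fin (suc m) → Bool) →
    count (λ j → h (π ⟨$⟩ʳ zero) (π ⟨$⟩ʳ suc j)) ≡ count (λ j → h zero (suc j))
  count-leaves-permute h =
    trans (count-cong (λ j → cong₂ h π-root (π-leaf j)))
          (ΣFin-permute (λ j → indicator (h zero (suc j))) (remove zero π))

  isCounted-permute : (α : Vec ℕ ℓ) (L L′ : Labeling (suc m)) →
    (∀ v → lab L (π ⟨$⟩ʳ v) ≡ lab L′ v) → (i : Fin ℓ) (k : ℕ) (κ : Coloring (suc m) ℓ) →
    isCounted α L′ i k (κ ∘ (π ⟨$⟩ʳ_)) ≡ isCounted α L i k κ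
  isCounted-permute α L L′ relabel i k κ =
    cong₂ _∧_ (allᶠ-leaves-permute (λ u v → not (κ u ==ᶠ κ v)))
     (cong₂ _∧_ (hasContent-permute α κ π)
      (cong₂ _∧_ (cong (λ v → κ v ==ᶠ i) π-root) (cong (_==ⁿ k) asc≡)))
    where
    ascent : Fin (suc m) → Fin (suc m) → Bool
    ascent u v = isAscent (lab L u) (lab L v) (κ u) (κ v)
    asc≡ : asc L′ (κ ∘ (π ⟨$⟩ʳ_)) ≡ asc L κ
    asc≡ = trans (count-cong (λ j →
                   cong₂ (λ a b → isAscent a b (κ (π ⟨$⟩ʳ zero)) (κ (π ⟨$⟩ʳ suc j)))
                         (sym (relabel zero)) (sym (relabel (suc j)))))
                 (count-leaves-permute ascent)

bCoeff-relabel : (α : Vec ℕ ℓ) (L L′ : Labeling (suc m)) → lab L zero ≡ lab L′ zero →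
  (i : Fin ℓ) (k : ℕ) → bCoeff α L i k ≡ bCoeff α L′ i k
bCoeff-relabel {ℓ} {m} α L L′ same-root i k = begin
  bCoeff α L i k ≡⟨⟩
  colouringSum (suc m) ℓ (indicator ∘ isCounted α L i k)
    ≡⟨ colouringSum-cong (λ κ →
         cong indicator (isCounted-permute π π-root α L L′ relabel i k κ)) ⟨
  colouringSum (suc m) ℓ (λ κ → indicator (isCounted α L′ i k (κ ∘ (π ⟨$⟩ʳ_))))
    ≡⟨ colouringSum-permuteVertices (indicator ∘ isCounted α L′ i k)
         (cong indicator ∘ isCounted-cong α L′ i k) π ⟩
  colouringSum (suc m) ℓ (indicator ∘ isCounted α L′ i k) ∎
  where
  open ≡-Reasoning
  π : Permutation′ (suc m)
  π = ⤖⇒↔ L′ ∘ₚ Perm.flip (⤖⇒↔ L)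
  relabel : ∀ v → lab L (π ⟨$⟩ʳ v) ≡ lab L′ v
  relabel v = inverseʳ (⤖⇒↔ L)
  π-root : π ⟨$⟩ʳ zero ≡ zero
  π-root = trans (cong (⤖⇒↔ L ⟨$⟩ˡ_) (sym same-root)) (inverseˡ (⤖⇒↔ L))

bCoeff-symmetry : (α : Vec ℕ ℓ) (i : Fin ℓ) (L L′ : Labeling (suc m)) →
  lab L′ zero ≡ opposite (lab L zero) →
  (k : ℕ) → bCoeff α L i k ≡ bCoeff (reverse α) L′ (opposite i) k
bCoeff-symmetry α i L L′ root k = trans (bCoeff-reverse α L i k)
  (bCoeff-relabel (reverse α) (reverseLabeling L) L′ (sym root) (opposite i) k)

lemma4p8 : (m ℓ : ℕ) → 2 ≤ suc m →
    (α : Vec ℕ ℓ) → All (1 ≤_) α → sum α ≡ suc m →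
    (i : Fin ℓ) → lookup α i ≡ 1 →
    ((r : Fin (suc m)) (L L′ : Labeling (suc m)) →
       lab L zero ≡ r → lab L′ zero ≡ opposite r →
       (k : ℕ) → bCoeff α L i k ≡ bCoeff (reverse α) L′ (opposite i) k)
    ×
    ((Ls Ls′ : Fin (suc m) → Labeling (suc m)) →
       ((r : Fin (suc m)) → lab (Ls r) zero ≡ r) →
       ((r : Fin (suc m)) → lab (Ls′ r) zero ≡ r) →
       (k : ℕ) → ΣFin (suc m) (λ r → bCoeff α (Ls r) i k)
               ≡ ΣFin (suc m) (λ r → bCoeff (reverse α) (Ls′ r) (opposite i) k))
lemma4p8 m ℓ _ α _ _ i _ =
  (λ r L L′ L-root L′-root → bCoeff-symmetry α i L L′ (opposite-root L-root L′-root))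
  , λ Ls Ls′ Ls-root Ls′-root k → trans
      (ΣFin-cong (λ r → bCoeff-symmetry α i (Ls r) (Ls′ (opposite r))
                          (opposite-root (Ls-root r) (Ls′-root (opposite r))) k))
      (ΣFin-permute (λ r → bCoeff (reverse α) (Ls′ r) (opposite i) k) Perm.reverse)
  where
  opposite-root : {r a b : Fin (suc m)} → a ≡ r → b ≡ opposite r → b ≡ opposite a
  opposite-root a≡r b≡r̄ = trans b≡r̄ (cong opposite (sym a≡r))
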